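{- Let $u=u_1u_2u_3\cdots=1101100110110\cdots$ be the fixed point starting with $1$ of the von Neumann substitution $\nu$: $0\mapsto 0$, $1\mapsto 110$, with positions indexed starting from $1$. Let $A=\{k\ge1:u_k=0\}=\{3,6,7,10,13,\dots\}$ and $B=\{k\ge1:u_k=1\}=\{1,2,4,5,8,9,\dots\}$. Then, with $\mathbb{N}=\{1,2,3,\dots\}$, $$A+A=\mathbb{N}\setminus\{1,2,3,4,5,7,8,11,15\},\qquad B+B=\mathbb{N}\setminus\{1\}.$$
   Context: For sets $X,Y$ of integers, $X+Y=\{x+y: x\in X, y\in Y\}$. -}

module Defs where

open import Data.Bool using (Bool; true; false)
open import Data.Nat using (ℕ; zero; suc; _+_; _≤_)
open import Data.List using (List; []; _∷_; concatMap)
open import Data.Product using (∃-syntax; _×_)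
open import Relation.Binary.PropositionalEquality using (_≡_)

-- Letters: true = 1, false = 0.
-- The von Neumann substitution ν : 0 ↦ 0, 1 ↦ 110.
νletter : Bool → List Bool
νletter true  = true ∷ true ∷ false ∷ []
νletter false = false ∷ []

ν : List Bool → List Bool
ν = concatMap νletter

νiter : ℕ → List Bool
νiter zero    = true ∷ []
νiter (suc n) = ν (νiter n)

-- 0-based lookup with a default (never used below: |ν^k(1)| = 2^(k+1) - 1 ≥ k)
at : List Bool → ℕ → Bool
at []       _       = false
at (x ∷ xs) zero    = x
at (x ∷ xs) (suc i) = at xs i

-- u_k for k ≥ 1 (1-based): the k-th letter of the fixed point u = lim ν^n(1).
-- ν^n(1) is a prefix of ν^(n+1)(1), and ν^k(1) already has length ≥ k.
u : ℕ → Bool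
u zero    = false   -- unused: positions start at 1
u (suc i) = at (νiter (suc i)) i

A : ℕ → Set
A k = 1 ≤ k × u k ≡ false

B : ℕ → Set
B k = 1 ≤ k × u k ≡ true

_⊕_ : (ℕ → Set) → (ℕ → Set) → ℕ → Set
(X ⊕ Y) n = ∃[ x ] ∃[ y ] (X x × Y y × x + y ≡ n)

{-# OPTIONS --safe #-}
-- Write w_n = ν^n(1). Then w_{n+1} = w_n w_n 0, so |w_{n+1}| = 2|w_n| + 1, and u has
-- every w_n as a prefix. By induction on n, every m ∈ [2, |w_n| + 1] is a sum of two
-- positions of 1s in w_n; and once |w_n| ≥ 15, every non-exceptional m ∈ [6, 2|w_n|] is a
-- sum of two positions of 0s. In both inductions the new range of w_{n+1} is covered by
-- shifting old sums by |w_n| (one summand in the second copy) or by 2|w_n| (both), plus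
-- the final letters; for the 0s, the shifted sums come from (|w_n|, 2|w_n|], which lies
-- above every exceptional value. The base case w_3 and the sums below 16 are decided by
-- computation.
module Submission where

open import Defs
open import Data.Bool using (Bool; true; false)
import Data.Bool.Properties as Bool
open import Data.Nat
open import Data.Nat.Properties
open import Data.List using (List; []; _∷_; _++_; length)
open import Data.List.Properties using (length-++; concatMap-++)
open import Data.List.Membership.Propositional using (_∉_; _∈_)
open import Data.List.Membership.DecPropositional _≟_ using (_∈?_)
open import Data.List.Relation.Unary.All as All using (all?)
open import Data.Product using (_×_; _,_; ∃-syntax)
open import Function.Bundles using (_⇔_; mk⇔; Equivalence)
open import Relation.Binary.PropositionalEquality
open import Data.Nat.Tactic.RingSolver using (solve-∀)
open import Relation.Nullary using (Dec; yes; no; ¬?; _×-dec_; _→-dec_; contradiction)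
open import Relation.Nullary.Decidable using (toWitness; map′)

ν-++ : ∀ xs ys → ν (xs ++ ys) ≡ ν xs ++ ν ys
ν-++ = concatMap-++ νletter

νiter-suc : ∀ n → νiter (suc n) ≡ νiter n ++ νiter n ++ false ∷ []
νiter-suc zero    = refl
νiter-suc (suc n) = begin
  ν (νiter (suc n))                         ≡⟨ cong ν (νiter-suc n) ⟩
  ν (νiter n ++ νiter n ++ false ∷ [])      ≡⟨ ν-++ (νiter n) _ ⟩
  ν (νiter n) ++ ν (νiter n ++ false ∷ [])  ≡⟨ cong (ν (νiter n) ++_) (ν-++ (νiter n) _) ⟩
  ν (νiter n) ++ ν (νiter n) ++ false ∷ []  ∎
  where open ≡-Reasoning

len : ℕ → ℕ
len n = length (νiter n)

len-suc : ∀ n → len (suc n) ≡ suc (len n + len n)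
len-suc n = begin
  length (νiter (suc n))                        ≡⟨ cong length (νiter-suc n) ⟩
  length (νiter n ++ νiter n ++ false ∷ [])     ≡⟨ length-++ (νiter n) ⟩
  len n + length (νiter n ++ false ∷ [])        ≡⟨ cong (len n +_) (length-++ (νiter n)) ⟩
  len n + (len n + 1)                           ≡⟨ cong (len n +_) (+-comm (len n) 1) ⟩
  len n + suc (len n)                           ≡⟨ +-suc (len n) (len n) ⟩
  suc (len n + len n)                           ∎
  where open ≡-Reasoning

n<len : ∀ n → n < len n
n<len zero    = s≤s z≤n
n<len (suc n) rewrite len-suc n = s≤s (≤-trans (n<len n) (m≤m+n (len n) (len n)))

at-++ˡ : ∀ xs ys {i} → i < length xs → at (xs ++ ys) i ≡ at xs i
at-++ˡ (x ∷ xs) ys {zero}  _         = refl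
at-++ˡ (x ∷ xs) ys {suc i} (s≤s i<n) = at-++ˡ xs ys i<n

at-++ʳ : ∀ xs ys i → at (xs ++ ys) (length xs + i) ≡ at ys i
at-++ʳ []       ys i = refl
at-++ʳ (x ∷ xs) ys i = at-++ʳ xs ys i

len-≤-suc : ∀ n → len n ≤ len (suc n)
len-≤-suc n rewrite len-suc n = m≤n⇒m≤1+n (m≤m+n (len n) (len n))

at-νiter-suc : ∀ n i → at (νiter (suc n)) i ≡ at (νiter n ++ νiter n ++ false ∷ []) i
at-νiter-suc n i = cong (λ w → at w i) (νiter-suc n)

-- Indices into ν^n(1) are 0-based: index i carries the letter u (suc i).
record LetterAt (n i : ℕ) (b : Bool) : Set where
  constructor _,_
  field
    bound  : i < len n
    letter : at (νiter n) i ≡ b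

letterAt? : ∀ n i b → Dec (LetterAt n i b)
letterAt? n i b =
  map′ (λ (p , q) → p , q) (λ ℓ → LetterAt.bound ℓ , LetterAt.letter ℓ)
       ((i <? len n) ×-dec (at (νiter n) i Bool.≟ b))

module _ {n i : ℕ} {b : Bool} where

  letter-prefix : LetterAt n i b → LetterAt (suc n) i b
  letter-prefix (i<len , i↦b) =
    <-≤-trans i<len (len-≤-suc n) ,
    trans (at-νiter-suc n i) (trans (at-++ˡ (νiter n) _ i<len) i↦b)

  letter-shift : LetterAt n i b → LetterAt (suc n) (len n + i) b
  letter-shift (i<len , i↦b) =
    subst (len n + i <_) (sym (len-suc n)) (s≤s (+-monoʳ-≤ (len n) (<⇒≤ i<len))) ,
    trans (at-νiter-suc n (len n + i))
          (trans (at-++ʳ (νiter n) _ i) (trans (at-++ˡ (νiter n) _ i<len) i↦b))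

letter-last : ∀ n → LetterAt (suc n) (len n + len n) false
letter-last n =
  subst (len n + len n <_) (sym (len-suc n)) ≤-refl ,
  trans (at-νiter-suc n (len n + len n))
        (trans (at-++ʳ (νiter n) _ (len n))
               (subst (λ k → at (νiter n ++ false ∷ []) k ≡ false) (+-identityʳ (len n))
                      (at-++ʳ (νiter n) _ 0)))

letter-head : ∀ n → LetterAt n 0 true
letter-head zero    = s≤s z≤n , refl
letter-head (suc n) = letter-prefix (letter-head n)

letter-prefix* : ∀ {m n i b} → m ≤′ n → LetterAt m i b → LetterAt n i b
letter-prefix* (≤′-reflexive refl) ℓ = ℓ
letter-prefix* (≤′-step m≤′n)      ℓ = letter-prefix (letter-prefix* m≤′n ℓ)

letter-unique : ∀ {n i b c} → LetterAt n i b → LetterAt n i c → b ≡ c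
letter-unique (_ , i↦b) (_ , i↦c) = trans (sym i↦b) i↦c

-- u (suc i) is letter i of ν^(i+1)(1), and ν^(i+1)(1), ν^n(1) are both prefixes of ν^(n ⊔ (i+1))(1).
u-letter : ∀ {n i b} → LetterAt n i b → u (suc i) ≡ b
u-letter {n} {i} ℓ = letter-unique (upTo (m≤n⊔m n (suc i)) ℓᵢ) (upTo (m≤m⊔n n (suc i)) ℓ)
  where
  upTo : ∀ {m b} → m ≤ n ⊔ suc i → LetterAt m i b → LetterAt (n ⊔ suc i) i b
  upTo m≤ = letter-prefix* (≤⇒≤′ m≤)
  ℓᵢ : LetterAt (suc i) i (u (suc i))
  ℓᵢ = <-trans (n<1+n i) (n<len (suc i)) , refl

Pos : Bool → ℕ → Set
Pos b k = 1 ≤ k × u k ≡ b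

SumAt : ℕ → Bool → ℕ → Set
SumAt n b m = ∃[ i ] ∃[ j ] (LetterAt n i b × LetterAt n j b × suc i + suc j ≡ m)

SumAt⇒⊕ : ∀ {n b m} → SumAt n b m → (Pos b ⊕ Pos b) m
SumAt⇒⊕ (i , j , ℓᵢ , ℓⱼ , i+j≡m) = suc i , suc j , (s≤s z≤n , u-letter ℓᵢ) , (s≤s z≤n , u-letter ℓⱼ) , i+j≡m

⊕-Pos⇒2≤ : ∀ {b c m} → (Pos b ⊕ Pos c) m → 2 ≤ m
⊕-Pos⇒2≤ (x , y , (1≤x , _) , (1≤y , _) , refl) = +-mono-≤ 1≤x 1≤y

module _ {n : ℕ} {b : Bool} where

  sum-prefix : ∀ {m} → SumAt n b m → SumAt (suc n) b m
  sum-prefix (i , j , ℓᵢ , ℓⱼ , i+j≡m) = i , j , letter-prefix ℓᵢ , letter-prefix ℓⱼ , i+j≡m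

  sum-shift : ∀ {s} → SumAt n b s → SumAt (suc n) b (len n + s)
  sum-shift (i , j , ℓᵢ , ℓⱼ , refl) =
    len n + i , j , letter-shift ℓᵢ , letter-prefix ℓⱼ , shift-one (len n) i j
    where
    shift-one : ∀ a i j → suc (a + i) + suc j ≡ a + (suc i + suc j)
    shift-one = solve-∀

  sum-shift-both : ∀ {s} → SumAt n b s → SumAt (suc n) b ((len n + len n) + s)
  sum-shift-both (i , j , ℓᵢ , ℓⱼ , refl) =
    len n + i , len n + j , letter-shift ℓᵢ , letter-shift ℓⱼ , shift-two (len n) i j
    where
    shift-two : ∀ a i j → suc (a + i) + suc (a + j) ≡ (a + a) + (suc i + suc j)
    shift-two = solve-∀

sum-last-last : ∀ n → SumAt (suc n) false (len (suc n) + len (suc n))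
sum-last-last n =
  len n + len n , len n + len n , letter-last n , letter-last n ,
  cong₂ _+_ (sym (len-suc n)) (sym (len-suc n))

sum-last-penultimate : ∀ n → let L = len (suc n) in SumAt (suc (suc n)) false (suc ((L + L) + (L + L)))
sum-last-penultimate n =
  L + L , L + (l + l) , letter-last (suc n) , letter-shift (letter-last n) ,
  cong (suc (L + L) +_) (begin
    suc (L + (l + l)) ≡⟨ +-suc L (l + l) ⟨
    L + suc (l + l)   ≡⟨ cong (L +_) (len-suc n) ⟨
    L + L             ∎)
  where
  open ≡-Reasoning
  L l : ℕ
  L = len (suc n)
  l = len n

∃-offset : ∀ a {c b m} → c + a ≤ m → m ≤ a + b → ∃[ s ] (c ≤ s × s ≤ b × m ≡ a + s)
∃-offset a {c} {b} {m} c+a≤m m≤a+b = m ∸ a , c≤m∸a , m∸a≤b , sym (m+[n∸m]≡n (≤-trans (m≤n+m a c) c+a≤m))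
  where
  c≤m∸a : c ≤ m ∸ a
  c≤m∸a = subst (_≤ m ∸ a) (m+n∸n≡m c a) (∸-monoˡ-≤ a c+a≤m)
  m∸a≤b : m ∸ a ≤ b
  m∸a≤b = subst (m ∸ a ≤_) (m+n∸m≡n a b) (∸-monoˡ-≤ a m≤a+b)

BCover : ℕ → Set
BCover n = ∀ m → 2 ≤ m → m ≤ suc (len n) → SumAt n true m

B-cover : ∀ n → BCover n
B-cover zero m 2≤m m≤2 = 0 , 0 , letter-head 0 , letter-head 0 , ≤-antisym 2≤m m≤2
B-cover (suc n) m 2≤m m≤ with m ≤? suc (len n)
... | yes m≤L+1 = sum-prefix (B-cover n m 2≤m m≤L+1)
... | no m≰L+1 with m ≤? len n + suc (len n)
...   | yes m≤2L+1 with ∃-offset (len n) (≰⇒> m≰L+1) m≤2L+1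
...     | s , 2≤s , s≤L+1 , refl = sum-shift (B-cover n s 2≤s s≤L+1)
B-cover (suc n) m _ m≤ | no _ | no m≰2L+1 =
  len n , len n , second-head , second-head , ≤-antisym (≰⇒> m≰2L+1) (subst (m ≤_) bound m≤)
  where
  second-head : LetterAt (suc n) (len n) true
  second-head = subst (λ i → LetterAt (suc n) i true) (+-identityʳ (len n)) (letter-shift (letter-head n))
  bound : suc (len (suc n)) ≡ suc (len n) + suc (len n)
  bound = cong suc (trans (len-suc n) (sym (+-suc (len n) (len n))))

exceptional : List ℕ
exceptional = 1 ∷ 2 ∷ 3 ∷ 4 ∷ 5 ∷ 7 ∷ 8 ∷ 11 ∷ 15 ∷ []

exceptional-≤15 : ∀ {k} → k ∈ exceptional → k ≤ 15
exceptional-≤15 = All.lookup (toWitness {a? = all? (_≤? 15) exceptional} _)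

16≤⇒∉exceptional : ∀ {k} → 16 ≤ k → k ∉ exceptional
16≤⇒∉exceptional 16≤k k∈ = <⇒≱ (s≤s (exceptional-≤15 k∈)) 16≤k

ACover : ℕ → Set
ACover n = ∀ m → 6 ≤ m → m ≤ len n + len n → m ∉ exceptional → SumAt n false m

A-cover-3 : ACover 3
A-cover-3 m 6≤m m≤30 m∉ with toWitness {a? = search} _ (s≤s m≤30) 6≤m m∉
  where
  Split : ℕ → ℕ → Set
  Split m i = LetterAt 3 i false × LetterAt 3 (m ∸ (2 + i)) false × suc i + suc (m ∸ (2 + i)) ≡ m
  split? : ∀ m i → Dec (Split m i)
  split? m i = letterAt? 3 i false ×-dec letterAt? 3 (m ∸ (2 + i)) false ×-dec (suc i + suc (m ∸ (2 + i)) ≟ m)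
  search : Dec (∀ {m} → m < 31 → 6 ≤ m → m ∉ exceptional → ∃[ i ] (i < 15 × Split m i))
  search = allUpTo? (λ m → 6 ≤? m →-dec (¬? (m ∈? exceptional) →-dec anyUpTo? (split? m) 15)) 31
... | i , _ , split = i , _ , split

module _ {n : ℕ} (15≤L : 15 ≤ len (suc n)) (cover : ACover (suc n)) where
  private
    L : ℕ
    L = len (suc n)

    cover-upper-half : ∀ {s} → suc L ≤ s → s ≤ L + L → SumAt (suc n) false s
    cover-upper-half {s} L<s s≤2L = cover _ (≤-trans (m≤m+n 6 10) 16≤s) s≤2L (16≤⇒∉exceptional 16≤s)
      where
      16≤s : 16 ≤ s
      16≤s = ≤-trans (s≤s 15≤L) L<s

    double-len : len (suc (suc n)) + len (suc (suc n)) ≡ suc (suc ((L + L) + (L + L)))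
    double-len = begin
      len (suc (suc n)) + len (suc (suc n)) ≡⟨ cong₂ _+_ (len-suc (suc n)) (len-suc (suc n)) ⟩
      suc ((L + L) + suc (L + L))         ≡⟨ cong suc (+-suc (L + L) (L + L)) ⟩
      suc (suc ((L + L) + (L + L)))       ∎
      where open ≡-Reasoning

  A-cover-step : ACover (suc (suc n))
  A-cover-step m 6≤m m≤ m∉ with m ≤? L + L
  ... | yes m≤2L = sum-prefix (cover m 6≤m m≤2L m∉)
  ... | no m≰2L with m ≤? L + (L + L)
  ...   | yes m≤3L with ∃-offset L {suc L} (≰⇒> m≰2L) m≤3L
  ...     | s , L<s , s≤2L , refl = sum-shift (cover-upper-half L<s s≤2L)
  A-cover-step m _ _ _ | no _ | no m≰3L with m ≤? (L + L) + (L + L)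
  ...   | yes m≤4L with ∃-offset (L + L) {suc L} (≰⇒> m≰3L) m≤4L
  ...     | s , L<s , s≤2L , refl = sum-shift-both (cover-upper-half L<s s≤2L)
  A-cover-step m _ m≤ _ | no _ | no _ | no m≰4L with m ≤? suc ((L + L) + (L + L))
  ... | yes m≤4L+1 rewrite ≤-antisym m≤4L+1 (≰⇒> m≰4L) = sum-last-penultimate n
  ... | no m≰4L+1 rewrite ≤-antisym m≤ (subst (_≤ m) (sym double-len) (≰⇒> m≰4L+1)) = sum-last-last (suc n)

15≤len : ∀ n → 15 ≤ len (3 + n)
15≤len n = LetterAt.bound (letter-prefix* (≤⇒≤′ (m≤m+n 3 n)) (letter-last 2))

A-cover : ∀ n → ACover (3 + n)
A-cover zero    = A-cover-3
A-cover (suc n) = A-cover-step (15≤len n) (A-cover n)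

A-sum∉exceptional : ∀ {x y} → A x → A y → x + y ∉ exceptional
A-sum∉exceptional {x} {y} x∈A y∈A x+y∈ =
  small-sums (s≤s (≤-trans (m≤m+n x y) x+y≤15)) (s≤s (≤-trans (m≤n+m y x) x+y≤15)) x∈A y∈A x+y∈
  where
  x+y≤15 : x + y ≤ 15
  x+y≤15 = exceptional-≤15 x+y∈
  small-sums : ∀ {x} → x < 16 → ∀ {y} → y < 16 → A x → A y → x + y ∉ exceptional
  small-sums = toWitness {a? = allUpTo? (λ x → allUpTo? (λ y → A? x →-dec (A? y →-dec ¬? (x + y ∈? exceptional))) 16) 16} _
    where
    A? : ∀ k → Dec (A k)
    A? k = (1 ≤? k) ×-dec (u k Bool.≟ false)

6≤-unexceptional : ∀ {n} → 1 ≤ n → n ∉ exceptional → 6 ≤ n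
6≤-unexceptional {n} 1≤n n∉ with n <? 6
... | yes n<6 = contradiction (toWitness {a? = allUpTo? (λ n → 1 ≤? n →-dec n ∈? exceptional) 6} _ n<6 1≤n) n∉
... | no n≮6  = ≮⇒≥ n≮6

2≤⇔1≤∧≢1 : ∀ {n} → 2 ≤ n ⇔ (1 ≤ n × n ≢ 1)
2≤⇔1≤∧≢1 = mk⇔ (λ { (s≤s 1≤n) → s≤s z≤n , λ { refl → contradiction 1≤n λ () } }) from
  where
  from : ∀ {n} → 1 ≤ n × n ≢ 1 → 2 ≤ n
  from {1}           (_ , n≢1) = contradiction refl n≢1
  from {suc (suc n)} _         = s≤s (s≤s z≤n)

theorem4 : ((n : ℕ) → (A ⊕ A) n ⇔ (1 ≤ n × n ∉ 1 ∷ 2 ∷ 3 ∷ 4 ∷ 5 ∷ 7 ∷ 8 ∷ 11 ∷ 15 ∷ []))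
         × ((n : ℕ) → (B ⊕ B) n ⇔ (1 ≤ n × n ≢ 1))
theorem4 = (λ n → mk⇔ A⊕A⇒ (A⊕A⇐ n)) , (λ n → mk⇔ B⊕B⇒ (B⊕B⇐ n))
  where
  A⊕A⇒ : ∀ {n} → (A ⊕ A) n → 1 ≤ n × n ∉ exceptional
  A⊕A⇒ sum@(_ , _ , x∈A , y∈A , refl) = ≤-trans (n≤1+n 1) (⊕-Pos⇒2≤ sum) , A-sum∉exceptional x∈A y∈A
  A⊕A⇐ : ∀ n → 1 ≤ n × n ∉ exceptional → (A ⊕ A) n
  A⊕A⇐ n (1≤n , n∉) = SumAt⇒⊕ (A-cover n n (6≤-unexceptional 1≤n n∉) n≤ n∉)
    where
    n≤ : n ≤ len (3 + n) + len (3 + n)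
    n≤ = ≤-trans (m≤n+m n 3) (≤-trans (<⇒≤ (n<len (3 + n))) (m≤m+n _ _))
  B⊕B⇒ : ∀ {n} → (B ⊕ B) n → 1 ≤ n × n ≢ 1
  B⊕B⇒ sum = Equivalence.to 2≤⇔1≤∧≢1 (⊕-Pos⇒2≤ sum)
  B⊕B⇐ : ∀ n → 1 ≤ n × n ≢ 1 → (B ⊕ B) n
  B⊕B⇐ n 1≤n∧n≢1 = SumAt⇒⊕ (B-cover n n (Equivalence.from 2≤⇔1≤∧≢1 1≤n∧n≢1) (m≤n⇒m≤1+n (<⇒≤ (n<len n))))
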